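{- Let $R \cong R_1 \times R_2 \times \cdots \times R_r$ with $r \geq 2$, where each $R_i$ ($1 \leq i \leq r$) is a finite commutative local ring with unity that is not a field. Then $\Gamma(R)$ is not a threshold graph.
   Context: For a finite commutative ring $R$ with unity, the zero-divisor graph $\Gamma(R)$ is the simple graph whose vertex set is all of $R$, two distinct vertices $x,y\in R$ being adjacent if and only if $xy=0$ in $R$. A graph is a threshold graph if it can be obtained from the one-vertex graph $K_1$ by repeatedly (any number of times, in any order) adding either an isolated vertex or a dominating vertex (a new vertex adjacent to all existing vertices). -}

module Defs where

open import Level using (0ℓ)
open import Data.Nat using (ℕ; zero; suc; _≤_)
open import Data.Fin using (Fin; zero; suc)
open import Data.Empty using (⊥)
open import Data.Sum using (_⊎_)
open import Data.Unit using (⊤)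
open import Data.Product using (Σ; ∃; ∃-syntax; _×_; _,_)
open import Relation.Nullary using (¬_)
open import Relation.Binary.PropositionalEquality using (_≡_; _≢_)
open import Algebra.Structures using (IsCommutativeRing)
open import Function.Bundles using (_⇔_)
open import Function.Definitions using (Bijective)

-- Finite commutative rings with unity.
-- Every finite ring is isomorphic to one whose carrier is Fin n, with
-- propositional equality as the ring equality.

record FiniteCommRing : Set₁ where
  field
    size   : ℕ
  Carrier : Set
  Carrier = Fin size
  field
    _+_ _*_ : Carrier → Carrier → Carrier
    -_      : Carrier → Carrier
    0# 1#   : Carrier
    isCommutativeRing : IsCommutativeRing _≡_ _+_ _*_ -_ 0# 1#

module _ (R : FiniteCommRing) where
  open FiniteCommRing R

  record IsIdeal (I : Carrier → Set) : Set where
    field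
      zero∈ : I 0#
      +-closed : ∀ {x y} → I x → I y → I (x + y)
      *-closed : ∀ r {x} → I x → I (r * x)

  record IsMaximalIdeal (M : Carrier → Set) : Set₁ where
    field
      isIdeal : IsIdeal M
      proper  : ¬ M 1#
      maximal : (J : Carrier → Set) → IsIdeal J →
                (∀ x → M x → J x) → J 1# ⊎ (∀ x → J x → M x)

  IsLocal : Set₁
  IsLocal = Σ (Carrier → Set) λ M → IsMaximalIdeal M ×
            ((N : Carrier → Set) → IsMaximalIdeal N → ∀ x → N x ⇔ M x)

  IsField : Set
  IsField = (1# ≢ 0#) × (∀ x → x ≢ 0# → ∃[ y ] (x * y ≡ 1#))

  ZDAdj : Carrier → Carrier → Set
  ZDAdj x y = (x ≢ y) × (x * y ≡ 0#)

-- Threshold graphs.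
-- A graph with n vertices is given by an adjacency relation on Fin n.
-- The new vertex added at each step is `zero`, old vertices are `suc i`.

addIsolated : ∀ {n} → (Fin n → Fin n → Set) → Fin (suc n) → Fin (suc n) → Set
addIsolated E zero    _       = ⊥
addIsolated E (suc i) zero    = ⊥
addIsolated E (suc i) (suc j) = E i j

addDominating : ∀ {n} → (Fin n → Fin n → Set) → Fin (suc n) → Fin (suc n) → Set
addDominating E zero    zero    = ⊥
addDominating E zero    (suc j) = ⊤
addDominating E (suc i) zero    = ⊤
addDominating E (suc i) (suc j) = E i j

data Threshold : (n : ℕ) → (Fin n → Fin n → Set) → Set₁ where
  K₁    : Threshold 1 (λ _ _ → ⊥)
  isol  : ∀ {n E} → Threshold n E → Threshold (suc n) (addIsolated E)
  domin : ∀ {n E} → Threshold n E → Threshold (suc n) (addDominating E)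

IsThresholdGraph : (n : ℕ) → (Fin n → Fin n → Set) → Set₁
IsThresholdGraph n adj =
  Σ (Fin n → Fin n → Set) λ E → Threshold n E ×
  Σ (Fin n → Fin n) λ f → Bijective _≡_ _≡_ f × (∀ i j → E i j ⇔ adj (f i) (f j))

-- R ≅ R₁ × ⋯ × R_r : a bijective unital ring homomorphism from R to the
-- product ring, whose elements are tuples (i : Fin r) → Carrier (Rs i),
-- equality of tuples being componentwise.

IsoToProduct : (R : FiniteCommRing) (r : ℕ) (Rs : Fin r → FiniteCommRing) → Set
IsoToProduct R r Rs =
  Σ (R.Carrier → (i : Fin r) → FiniteCommRing.Carrier (Rs i)) λ φ →
    (∀ x y i → φ (x R.+ y) i ≡ FiniteCommRing._+_ (Rs i) (φ x i) (φ y i)) ×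
    (∀ x y i → φ (x R.* y) i ≡ FiniteCommRing._*_ (Rs i) (φ x i) (φ y i)) ×
    (∀ i → φ R.1# i ≡ FiniteCommRing.1# (Rs i)) ×
    (∀ x y → (∀ i → φ x i ≡ φ y i) → x ≡ y) ×
    (∀ (g : (i : Fin r) → FiniteCommRing.Carrier (Rs i)) → ∃[ x ] (∀ i → φ x i ≡ g i))
  where module R = FiniteCommRing R

-- A threshold graph contains no 2-switch: four vertices x₁ y₁ x₂ y₂ with
-- edges x₁y₁ and x₂y₂ but non-edges x₁y₂ and x₂y₁ (the latter pairs being
-- distinct). Indeed the most recently added vertex is isolated or dominating,
-- so it cannot take part in one. On the other hand a ring that is not a
-- field has an element c ∉ {0, 1}, so if c₁ ∈ R₁ and c₂ ∈ R₂ are such elements,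
-- the vertices (1,0,0,…), (0,c₂,0,…), (0,1,0,…), (c₁,0,0,…) of Γ(R₁ × R₂ × ⋯)
-- form a 2-switch. Locality of the factors is only needed to know 1 ≠ 0.
module Submission where

open import Defs
open import Algebra.Bundles using (Group)
open import Algebra.Structures using (IsCommutativeRing)
open import Data.Empty using (⊥-elim)
open import Data.Fin using (Fin; zero; suc)
open import Data.Fin.Properties using (all?; ¬∀⟶∃¬; _≟_)
open import Data.Nat using (ℕ; suc; _≤_; s≤s)
open import Data.Product using (∃-syntax; _×_; _,_; proj₁; proj₂)
open import Data.Sum using (inj₁; inj₂)
open import Data.Unit using (tt)
open import Function.Base using (_∘′_)
open import Function.Bundles using (_⇔_; Equivalence)
open import Function.Definitions using (Surjective)
open import Relation.Binary.PropositionalEquality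
open import Relation.Nullary using (¬_; yes; no)
open import Relation.Nullary.Decidable using (_⊎-dec_)

record TwoSwitch {A : Set} (E : A → A → Set) : Set where
  constructor twoSwitch
  field
    {x₁ y₁ x₂ y₂} : A
    x₁≢y₂ : x₁ ≢ y₂
    x₂≢y₁ : x₂ ≢ y₁
    x₁y₁  : E x₁ y₁
    x₂y₂  : E x₂ y₂
    ¬x₁y₂ : ¬ E x₁ y₂
    ¬x₂y₁ : ¬ E x₂ y₁

suc≢suc : ∀ {n} {i j : Fin n} → suc i ≢ suc j → i ≢ j
suc≢suc si≢sj i≡j = si≢sj (cong suc i≡j)

Threshold⇒¬TwoSwitch : ∀ {n E} → Threshold n E → ¬ TwoSwitch E
Threshold⇒¬TwoSwitch K₁ (twoSwitch _ _ () _ _ _)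
Threshold⇒¬TwoSwitch (isol t)
  (twoSwitch {suc _} {suc _} {suc _} {suc _} x₁≢y₂ x₂≢y₁ x₁y₁ x₂y₂ ¬x₁y₂ ¬x₂y₁) =
  Threshold⇒¬TwoSwitch t (twoSwitch (suc≢suc x₁≢y₂) (suc≢suc x₂≢y₁) x₁y₁ x₂y₂ ¬x₁y₂ ¬x₂y₁)
Threshold⇒¬TwoSwitch (domin t) (twoSwitch {zero} {_} {_} {zero} x₁≢y₂ _ _ _ _ _) = x₁≢y₂ refl
Threshold⇒¬TwoSwitch (domin t) (twoSwitch {zero} {_} {_} {suc _} _ _ _ _ ¬x₁y₂ _) = ¬x₁y₂ tt
Threshold⇒¬TwoSwitch (domin t) (twoSwitch {suc _} {_} {_} {zero} _ _ _ _ ¬x₁y₂ _) = ¬x₁y₂ tt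
Threshold⇒¬TwoSwitch (domin t) (twoSwitch {suc _} {zero} {zero} {suc _} _ x₂≢y₁ _ _ _ _) = x₂≢y₁ refl
Threshold⇒¬TwoSwitch (domin t) (twoSwitch {suc _} {zero} {suc _} {suc _} _ _ _ _ _ ¬x₂y₁) = ¬x₂y₁ tt
Threshold⇒¬TwoSwitch (domin t) (twoSwitch {suc _} {suc _} {zero} {suc _} _ _ _ _ _ ¬x₂y₁) = ¬x₂y₁ tt
Threshold⇒¬TwoSwitch (domin t)
  (twoSwitch {suc _} {suc _} {suc _} {suc _} x₁≢y₂ x₂≢y₁ x₁y₁ x₂y₂ ¬x₁y₂ ¬x₂y₁) =
  Threshold⇒¬TwoSwitch t (twoSwitch (suc≢suc x₁≢y₂) (suc≢suc x₂≢y₁) x₁y₁ x₂y₂ ¬x₁y₂ ¬x₂y₁)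

TwoSwitch-pullback : ∀ {A B : Set} {E : A → A → Set} {F : B → B → Set} {f : A → B} →
  Surjective _≡_ _≡_ f → (∀ a a′ → E a a′ ⇔ F (f a) (f a′)) → TwoSwitch F → TwoSwitch E
TwoSwitch-pullback {E = E} {F} {f} f-surj E⇔F (twoSwitch x₁≢y₂ x₂≢y₁ x₁y₁ x₂y₂ ¬x₁y₂ ¬x₂y₁) =
  twoSwitch (pre-≢ x₁≢y₂) (pre-≢ x₂≢y₁) (pre-edge x₁y₁) (pre-edge x₂y₂)
            (pre-nonEdge ¬x₁y₂) (pre-nonEdge ¬x₂y₁)
  where
  pre = λ b → proj₁ (f-surj b)
  f∘pre : ∀ b → f (pre b) ≡ b
  f∘pre b = proj₂ (f-surj b) refl

  pre-≢ : ∀ {b b′} → b ≢ b′ → pre b ≢ pre b′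
  pre-≢ {b} {b′} b≢b′ e = b≢b′ (trans (sym (f∘pre b)) (trans (cong f e) (f∘pre b′)))

  pre-edge : ∀ {b b′} → F b b′ → E (pre b) (pre b′)
  pre-edge {b} {b′} Fbb′ =
    Equivalence.from (E⇔F _ _) (subst₂ F (sym (f∘pre b)) (sym (f∘pre b′)) Fbb′)

  pre-nonEdge : ∀ {b b′} → ¬ F b b′ → ¬ E (pre b) (pre b′)
  pre-nonEdge {b} {b′} ¬Fbb′ Ebb′ =
    ¬Fbb′ (subst₂ F (f∘pre b) (f∘pre b′) (Equivalence.to (E⇔F _ _) Ebb′))

IsThresholdGraph⇒¬TwoSwitch : ∀ {n adj} → IsThresholdGraph n adj → ¬ TwoSwitch adj
IsThresholdGraph⇒¬TwoSwitch (_ , threshold , _ , (_ , f-surj) , E⇔adj) =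
  Threshold⇒¬TwoSwitch threshold ∘′ TwoSwitch-pullback f-surj E⇔adj

module FiniteCommRingProperties (S : FiniteCommRing) where
  open FiniteCommRing S
  open IsCommutativeRing isCommutativeRing public using (zeroˡ; zeroʳ; *-identityˡ; *-identityʳ)
  open IsCommutativeRing isCommutativeRing using (+-isGroup)

  +-group : Group _ _
  +-group = record { isGroup = +-isGroup }

  open import Algebra.Properties.Group +-group using (identityˡ-unique)

  +-idem⇒≡0# : ∀ {a} → a + a ≡ a → a ≡ 0#
  +-idem⇒≡0# {a} = identityˡ-unique a a

  ≢0#⇒1#≢0# : ∀ {c} → c ≢ 0# → 1# ≢ 0#
  ≢0#⇒1#≢0# {c} c≢0 1≡0 = c≢0 (begin
    c       ≡⟨ sym (*-identityʳ c) ⟩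
    c * 1#  ≡⟨ cong (c *_) 1≡0 ⟩
    c * 0#  ≡⟨ zeroʳ c ⟩
    0#      ∎)
    where open ≡-Reasoning

  IsLocal⇒1#≢0# : IsLocal S → 1# ≢ 0#
  IsLocal⇒1#≢0# (M , isMaximal , _) 1≡0 =
    proper (subst M (sym 1≡0) (IsIdeal.zero∈ (IsMaximalIdeal.isIdeal isMaximal)))
    where open IsMaximalIdeal isMaximal using (proper)

  -- If every element were 0 or 1, S would be a field (1 · 1 = 1); finiteness makes this decidable.
  ¬IsField⇒∃≢0#,1# : 1# ≢ 0# → ¬ IsField S → ∃[ c ] c ≢ 0# × c ≢ 1#
  ¬IsField⇒∃≢0#,1# 1≢0 ¬field with all? (λ c → (c ≟ 0#) ⊎-dec (c ≟ 1#))
  ... | yes all0or1 = ⊥-elim (¬field (1≢0 , invertible))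
    where
    invertible : ∀ c → c ≢ 0# → ∃[ d ] c * d ≡ 1#
    invertible c c≢0 with all0or1 c
    ... | inj₁ c≡0 = ⊥-elim (c≢0 c≡0)
    ... | inj₂ refl = 1# , *-identityˡ 1#
  ... | no ¬all0or1 with ¬∀⟶∃¬ size _ (λ c → (c ≟ 0#) ⊎-dec (c ≟ 1#)) ¬all0or1
  ...   | c , c∉01 = c , c∉01 ∘′ inj₁ , c∉01 ∘′ inj₂

module IsoToProductProperties (R : FiniteCommRing) {r : ℕ} (Rs : Fin r → FiniteCommRing)
                              (R≅ : IsoToProduct R r Rs) where
  private
    module R = FiniteCommRing R
    module Rᵢ (i : Fin r) where
      open FiniteCommRing (Rs i) public
      open FiniteCommRingProperties (Rs i) public

  φ : R.Carrier → (i : Fin r) → Rᵢ.Carrier i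
  φ = proj₁ R≅

  private
    φ-+ = proj₁ (proj₂ R≅)
    φ-* = proj₁ (proj₂ (proj₂ R≅))
    φ-injective = proj₁ (proj₂ (proj₂ (proj₂ (proj₂ R≅))))

  φ-surjective : ∀ g → ∃[ x ] ∀ i → φ x i ≡ g i
  φ-surjective = proj₂ (proj₂ (proj₂ (proj₂ (proj₂ R≅))))

  φ-0# : ∀ i → φ R.0# i ≡ Rᵢ.0# i
  φ-0# i = Rᵢ.+-idem⇒≡0# i (begin
    Rᵢ._+_ i (φ R.0# i) (φ R.0# i)  ≡⟨ sym (φ-+ R.0# R.0# i) ⟩
    φ (R.0# R.+ R.0#) i             ≡⟨ cong (λ z → φ z i) (+-identityˡ R.0#) ⟩
    φ R.0# i                        ∎)
    where
    open ≡-Reasoning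
    open IsCommutativeRing R.isCommutativeRing using (+-identityˡ)

  ≢⇐component : ∀ {x y} i → φ x i ≢ φ y i → x ≢ y
  ≢⇐component i φxᵢ≢φyᵢ x≡y = φxᵢ≢φyᵢ (cong (λ z → φ z i) x≡y)

  *≡0#⇐componentwise : ∀ {x y} → (∀ i → Rᵢ._*_ i (φ x i) (φ y i) ≡ Rᵢ.0# i) → x R.* y ≡ R.0#
  *≡0#⇐componentwise {x} {y} xy≡0 = φ-injective _ _ λ i →
    trans (φ-* x y i) (trans (xy≡0 i) (sym (φ-0# i)))

  *≢0#⇐component : ∀ {x y} i → Rᵢ._*_ i (φ x i) (φ y i) ≢ Rᵢ.0# i → x R.* y ≢ R.0#
  *≢0#⇐component {x} {y} i xᵢyᵢ≢0 xy≡0 =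
    xᵢyᵢ≢0 (trans (sym (φ-* x y i)) (trans (cong (λ z → φ z i) xy≡0) (φ-0# i)))

module FirstTwoFactors (R : FiniteCommRing) {r : ℕ} (Rs : Fin (suc (suc r)) → FiniteCommRing)
                       (R≅ : IsoToProduct R (suc (suc r)) Rs) where
  open IsoToProductProperties R Rs R≅
  private
    module R = FiniteCommRing R
    module Rᵢ (i : Fin (suc (suc r))) where
      open FiniteCommRing (Rs i) public
      open FiniteCommRingProperties (Rs i) public
    module R₀ = Rᵢ zero
    module R₁ = Rᵢ (suc zero)

  ⟨_,_⟩ : R₀.Carrier → R₁.Carrier → (i : Fin (suc (suc r))) → Rᵢ.Carrier i
  ⟨ x , y ⟩ zero          = x
  ⟨ x , y ⟩ (suc zero)    = y
  ⟨ x , y ⟩ (suc (suc i)) = Rᵢ.0# (suc (suc i))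

  ⟪_,_⟫ : R₀.Carrier → R₁.Carrier → R.Carrier
  ⟪ x , y ⟫ = proj₁ (φ-surjective ⟨ x , y ⟩)

  φ-⟪⟫ : ∀ {x y} i → φ ⟪ x , y ⟫ i ≡ ⟨ x , y ⟩ i
  φ-⟪⟫ {x} {y} = proj₂ (φ-surjective ⟨ x , y ⟩)

  module _ {x x′ : R₀.Carrier} {y y′ : R₁.Carrier} where

    ⟪⟫-≢ˡ : x ≢ x′ → ⟪ x , y ⟫ ≢ ⟪ x′ , y′ ⟫
    ⟪⟫-≢ˡ = ≢⇐component zero ∘′ subst₂ _≢_ (sym (φ-⟪⟫ zero)) (sym (φ-⟪⟫ zero))

    ⟪⟫-≢ʳ : y ≢ y′ → ⟪ x , y ⟫ ≢ ⟪ x′ , y′ ⟫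
    ⟪⟫-≢ʳ = ≢⇐component (suc zero) ∘′ subst₂ _≢_ (sym (φ-⟪⟫ (suc zero))) (sym (φ-⟪⟫ (suc zero)))

    ⟪⟫-*≡0# : R₀._*_ x x′ ≡ R₀.0# → R₁._*_ y y′ ≡ R₁.0# → ⟪ x , y ⟫ R.* ⟪ x′ , y′ ⟫ ≡ R.0#
    ⟪⟫-*≡0# xx′≡0 yy′≡0 = *≡0#⇐componentwise λ i →
      subst₂ (λ a b → Rᵢ._*_ i a b ≡ Rᵢ.0# i) (sym (φ-⟪⟫ i)) (sym (φ-⟪⟫ i)) (⟨⟩-*≡0# i)
      where
      ⟨⟩-*≡0# : ∀ i → Rᵢ._*_ i (⟨ x , y ⟩ i) (⟨ x′ , y′ ⟩ i) ≡ Rᵢ.0# i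
      ⟨⟩-*≡0# zero          = xx′≡0
      ⟨⟩-*≡0# (suc zero)    = yy′≡0
      ⟨⟩-*≡0# (suc (suc i)) = Rᵢ.zeroˡ (suc (suc i)) _

    ⟪⟫-*≢0#ˡ : R₀._*_ x x′ ≢ R₀.0# → ⟪ x , y ⟫ R.* ⟪ x′ , y′ ⟫ ≢ R.0#
    ⟪⟫-*≢0#ˡ = *≢0#⇐component zero ∘′
      subst₂ (λ a b → R₀._*_ a b ≢ R₀.0#) (sym (φ-⟪⟫ zero)) (sym (φ-⟪⟫ zero))

    ⟪⟫-*≢0#ʳ : R₁._*_ y y′ ≢ R₁.0# → ⟪ x , y ⟫ R.* ⟪ x′ , y′ ⟫ ≢ R.0#
    ⟪⟫-*≢0#ʳ = *≢0#⇐component (suc zero) ∘′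
      subst₂ (λ a b → R₁._*_ a b ≢ R₁.0#) (sym (φ-⟪⟫ (suc zero))) (sym (φ-⟪⟫ (suc zero)))

  ZDAdj-twoSwitch : ∃[ c ] c ≢ R₀.0# × c ≢ R₀.1# → ∃[ c ] c ≢ R₁.0# × c ≢ R₁.1# →
                    TwoSwitch (ZDAdj R)
  ZDAdj-twoSwitch (c₁ , c₁≢0 , c₁≢1) (c₂ , c₂≢0 , c₂≢1) =
    twoSwitch {x₁ = ⟪ R₀.1# , R₁.0# ⟫} {y₁ = ⟪ R₀.0# , c₂ ⟫}
              {x₂ = ⟪ R₀.0# , R₁.1# ⟫} {y₂ = ⟪ c₁ , R₁.0# ⟫}
      (⟪⟫-≢ˡ (c₁≢1 ∘′ sym))
      (⟪⟫-≢ʳ (c₂≢1 ∘′ sym))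
      (⟪⟫-≢ˡ (R₀.≢0#⇒1#≢0# c₁≢0) , ⟪⟫-*≡0# (R₀.zeroʳ R₀.1#) (R₁.zeroˡ c₂))
      (⟪⟫-≢ʳ (R₁.≢0#⇒1#≢0# c₂≢0) , ⟪⟫-*≡0# (R₀.zeroˡ c₁) (R₁.zeroʳ R₁.1#))
      (⟪⟫-*≢0#ˡ (subst (_≢ R₀.0#) (sym (R₀.*-identityˡ c₁)) c₁≢0) ∘′ proj₂)
      (⟪⟫-*≢0#ʳ (subst (_≢ R₁.0#) (sym (R₁.*-identityˡ c₂)) c₂≢0) ∘′ proj₂)

mainTheorem7 : (R : FiniteCommRing) (r : ℕ) (Rs : Fin r → FiniteCommRing) →
    2 ≤ r →
    (∀ i → IsLocal (Rs i)) →
    (∀ i → ¬ IsField (Rs i)) →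
    IsoToProduct R r Rs →
    ¬ IsThresholdGraph (FiniteCommRing.size R) (ZDAdj R)
mainTheorem7 R (suc (suc r)) Rs (s≤s (s≤s _)) local ¬field R≅ threshold =
  IsThresholdGraph⇒¬TwoSwitch threshold
    (FirstTwoFactors.ZDAdj-twoSwitch R Rs R≅ (nontrivialElement zero) (nontrivialElement (suc zero)))
  where
  nontrivialElement : ∀ i → ∃[ c ] c ≢ FiniteCommRing.0# (Rs i) × c ≢ FiniteCommRing.1# (Rs i)
  nontrivialElement i = ¬IsField⇒∃≢0#,1# (IsLocal⇒1#≢0# (local i)) (¬field i)
    where open FiniteCommRingProperties (Rs i)
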